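{- Let $l\ge3$, $d\ge1$. An element $f\in W(l,d)$ is regular if and only if either $L\subseteq Dom(f)$ and the restriction of $f$ to $L$ is a permutation of $L$, or $|Im(f)\cap L|\le1$.
   Context: For $l\ge3$, $d\ge1$, let $V=\{1,\dots,l+d\}$, $L=\{1,\dots,l\}$, $D=\{l+1,\dots,l+d\}$, and let $M(l,d)$ be the pairwise balanced design on $V$ whose blocks are $L$ together with all $\{i,j\}$ with $l+1\le j\le l+d$, $1\le i<j$. A subsystem is a set $F\subseteq V$ such that for all distinct $x,y\in F$ the unique block containing $x,y$ lies in $F$. For a partial function $f$, $Im(f)=f(Dom(f))$ and $f^{ -w}(B)=f^{ -1}(B)\cup(V\setminus Dom(f))$; $W(l,d)$ is the monoid (under composition of partial functions) of all partial functions $f:V\to V$ such that $f^{ -w}(F)$ is a subsystem for every subsystem $F$. An element $f$ is regular if $fgf=f$ for some $g\in W(l,d)$. -}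

module Defs where

open import Data.Nat using (ℕ; _+_; _<_; _≤_; _<?_)
open import Data.Fin using (Fin; toℕ)
open import Data.Fin.Subset using (Subset; _∈_; _⊆_)
open import Data.Fin.Subset.Properties using (_∈?_)
open import Data.Vec using (tabulate)
open import Data.Maybe using (Maybe; just; nothing; maybe; _>>=_)
open import Data.Product using (Σ; ∃; ∃-syntax; _×_)
open import Data.Sum using (_⊎_)
open import Relation.Nullary using (¬_; does)
open import Relation.Binary.PropositionalEquality using (_≡_; _≢_)
open import Function.Bundles using (_⇔_)

-- The point set V = {1,…,l+d} is represented by Fin (l + d); the element
-- k : Fin (l + d) stands for the point toℕ k + 1.
-- So L = {1,…,l} corresponds to toℕ k < l, and D to l ≤ toℕ k.

V : ℕ → ℕ → Set
V l d = Fin (l + d)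

InL : ∀ {l d} → V l d → Set
InL {l} x = toℕ x < l

InD : ∀ {l d} → V l d → Set
InD {l} x = l ≤ toℕ x

IsBlock : (l d : ℕ) → Subset (l + d) → Set
IsBlock l d B =
  (∀ x → (x ∈ B) ⇔ InL {l} {d} x)
  ⊎ (Σ (V l d) λ i → Σ (V l d) λ j →
       InD {l} {d} j × toℕ i < toℕ j × (∀ x → (x ∈ B) ⇔ (x ≡ i ⊎ x ≡ j)))

IsSubsystem : (l d : ℕ) → Subset (l + d) → Set
IsSubsystem l d F =
  ∀ x y → x ≢ y → x ∈ F → y ∈ F →
  ∀ B → IsBlock l d B → x ∈ B → y ∈ B → B ⊆ F

PFun : ℕ → ℕ → Set
PFun l d = V l d → Maybe (V l d)

compP : (l d : ℕ) → PFun l d → PFun l d → PFun l d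
compP l d f g x = g x >>= f

-- Weak preimage f^{-w}(B) = f^{-1}(B) ∪ (V \ Dom f).
preW : (l d : ℕ) → PFun l d → Subset (l + d) → Subset (l + d)
preW l d f B = tabulate (λ x → maybe (λ y → does (y ∈? B)) Data.Bool.true (f x))
  where import Data.Bool

InW : (l d : ℕ) → PFun l d → Set
InW l d f = ∀ F → IsSubsystem l d F → IsSubsystem l d (preW l d f F)

Regular : (l d : ℕ) → PFun l d → Set
Regular l d f = Σ (PFun l d) λ g → InW l d g × (∀ x → compP l d f (compP l d g f) x ≡ f x)

PermutesL : (l d : ℕ) → PFun l d → Set
PermutesL l d f =
  (∀ x → InL {l} {d} x → Σ (V l d) λ y → f x ≡ just y × InL {l} {d} y)
  × (∀ x y → InL {l} {d} x → InL {l} {d} y → f x ≡ f y → x ≡ y)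
  × (∀ y → InL {l} {d} y → Σ (V l d) λ x → InL {l} {d} x × f x ≡ just y)

ImL≤1 : (l d : ℕ) → PFun l d → Set
ImL≤1 l d f =
  ∀ x y a b → f x ≡ just a → f y ≡ just b → InL {l} {d} a → InL {l} {d} b → a ≡ b

module Submission where

-- Subsystems of M(l,d) are exactly the sets that, once they contain two
-- distinct points of L, contain all of L (the pair blocks impose nothing).
-- Regularity of f is equivalent to having a "section" g ∈ W(l,d): for every
-- value y = f(x), g(y) is defined and is a preimage of y under f.
--
-- The heart of the proof is a rigidity lemma: if h ∈ W(l,d) takes two
-- distinct values on L, then h is defined and injective on L and maps L into L
-- (weak preimages of singletons, and of {c, c'} with c ∉ L, are subsystems);
-- by counting, h then permutes L.
--
-- (⇒) If |Im f ∩ L| ≥ 2, pick x, y with f x = a ≠ b = f y in L and a section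
--     g; g takes the distinct values g a, g b on L, so by rigidity they lie in
--     L, and then f takes distinct values on L, so f permutes L.
-- (⇐) In both cases we build a section g that on D picks any preimage, and on
--     L either inverts the permutation f (so g embeds L into L) or is constant
--     (a preimage of the unique point of Im f ∩ L); either way g ∈ W(l,d).

open import Defs
open import Data.Nat using (ℕ; _+_; _≤_; _<_; _<?_; zero; suc; s≤s; z≤n)
open import Data.Nat.Properties using (1+n≰n)
open import Data.Bool using (Bool; true)
open import Data.Fin using (Fin; toℕ; fromℕ<; _↑ˡ_; punchOut; _≟_)
import Data.Fin as Fin
open import Data.Fin.Properties
  using (any?; toℕ-injective; toℕ-fromℕ<; toℕ-↑ˡ; toℕ<n; ↑ˡ-injective; punchOut-injective; injective⇒≤)
open import Data.Fin.Subset using (Subset; _∈_; ⁅_⁆; _∪_)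
open import Data.Fin.Subset.Properties using (_∈?_; x∈⁅x⁆; x∈⁅y⁆⇒x≡y; x∈p∪q⁻; x∈p∪q⁺)
open import Data.Vec using (tabulate)
open import Data.Vec.Properties using (lookup∘tabulate; lookup⇒[]=; []=⇒lookup)
open import Data.Maybe using (Maybe; just; nothing; maybe; _>>=_)
open import Data.Maybe.Properties using (just-injective) renaming (≡-dec to ≡-decMaybe)
open import Data.Product using (Σ; ∃; _×_; _,_; proj₁; proj₂)
open import Data.Sum using (_⊎_; inj₁; inj₂)
open import Data.Empty using (⊥; ⊥-elim)
open import Function using (_∘_)
open import Function.Bundles using (_⇔_; mk⇔; module Equivalence)
open import Function.Definitions using (Injective)
open import Relation.Nullary using (Dec; yes; no; does; _×-dec_; contradiction)
open import Relation.Nullary.Decidable using (dec-true)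
open import Relation.Unary using (Decidable)
open import Relation.Binary.PropositionalEquality using (_≡_; _≢_; refl; sym; trans; cong; subst)

open Equivalence using (to; from)

∈-tabulate : ∀ {n} (h : Fin n → Bool) {x} → x ∈ tabulate h ⇔ h x ≡ true
∈-tabulate h {x} = mk⇔ (λ m → trans (sym (lookup∘tabulate h x)) ([]=⇒lookup m))
                       (λ e → lookup⇒[]= x (tabulate h) (trans (lookup∘tabulate h x) e))

does⇔ : ∀ {A : Set} (a? : Dec A) → does a? ≡ true ⇔ A
does⇔ a? = mk⇔ (sound a?) (dec-true a?)
  where
  sound : ∀ {A : Set} (a? : Dec A) → does a? ≡ true → A
  sound (yes a) _ = a
  sound (no _) ()

pair-cover : ∀ {A : Set} {i j x y z : A} → x ≢ y →
  x ≡ i ⊎ x ≡ j → y ≡ i ⊎ y ≡ j → z ≡ i ⊎ z ≡ j → z ≡ x ⊎ z ≡ y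
pair-cover x≢y (inj₁ refl) (inj₁ refl) _ = ⊥-elim (x≢y refl)
pair-cover x≢y (inj₂ refl) (inj₂ refl) _ = ⊥-elim (x≢y refl)
pair-cover _ (inj₁ refl) _ (inj₁ refl) = inj₁ refl
pair-cover _ (inj₂ refl) _ (inj₂ refl) = inj₁ refl
pair-cover _ _ (inj₁ refl) (inj₁ refl) = inj₂ refl
pair-cover _ _ (inj₂ refl) (inj₂ refl) = inj₂ refl

finite-dichotomy : ∀ {n} {P R : Fin n → Set} →
  (∀ x → P x ⊎ R x) → (∀ x → P x) ⊎ ∃ R
finite-dichotomy {zero} _ = inj₁ λ ()
finite-dichotomy {suc n} pr with pr Fin.zero | finite-dichotomy (pr ∘ Fin.suc)
... | inj₂ r | _ = inj₂ (Fin.zero , r)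
... | inj₁ _ | inj₂ (x , r) = inj₂ (Fin.suc x , r)
... | inj₁ p | inj₁ ps = inj₁ λ { Fin.zero → p ; (Fin.suc x) → ps x }

-- An injective self-map of a finite set is surjective: a missed value would
-- give, via punchOut, an injection Fin (suc m) → Fin m.
injective⇒surjective : ∀ {n} (k : Fin n → Fin n) → Injective _≡_ _≡_ k → ∀ y → ∃ λ x → k x ≡ y
injective⇒surjective {zero} k _ ()
injective⇒surjective {suc m} k k-inj y with any? (λ x → k x ≟ y)
... | yes found = found
... | no missed = contradiction (injective⇒≤ squeezed-injective) 1+n≰n
  where
  avoids : ∀ x → y ≢ k x
  avoids x e = missed (x , sym e)
  squeezed-injective : Injective _≡_ _≡_ (λ x → punchOut (avoids x))
  squeezed-injective e = k-inj (punchOut-injective (avoids _) (avoids _) e)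

fromDec : ∀ {n} {P : Fin n → Set} → Dec (∃ P) → Maybe (Fin n)
fromDec (yes (x , _)) = just x
fromDec (no _) = nothing

choose : ∀ {n} {P : Fin n → Set} → Decidable P → Maybe (Fin n)
choose P? = fromDec (any? P?)

choose-sound : ∀ {n} {P : Fin n → Set} (P? : Decidable P) {x} → choose P? ≡ just x → P x
choose-sound P? = sound (any? P?)
  where
  sound : ∀ {n} {P : Fin n → Set} (dp : Dec (∃ P)) {x} → fromDec dp ≡ just x → P x
  sound (yes (_ , px)) refl = px

choose-complete : ∀ {n} {P : Fin n → Set} (P? : Decidable P) → ∃ P → ∃ λ x → choose P? ≡ just x
choose-complete P? = complete (any? P?)
  where
  complete : ∀ {n} {P : Fin n → Set} (dp : Dec (∃ P)) → ∃ P → ∃ λ x → fromDec dp ≡ just x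
  complete (yes (x , _)) _ = x , refl
  complete (no none) p = ⊥-elim (none p)

two-more-in-L : ∀ {l d} → 3 ≤ l → (z : V l d) →
  Σ (V l d) λ w → Σ (V l d) λ r →
    InL {l} {d} w × InL {l} {d} r × z ≢ w × z ≢ r × w ≢ r
two-more-in-L (s≤s (s≤s (s≤s z≤n))) z with z ≟ Fin.zero | z ≟ Fin.suc Fin.zero
... | yes refl | _ = Fin.suc Fin.zero , Fin.suc (Fin.suc Fin.zero) ,
      s≤s (s≤s z≤n) , s≤s (s≤s (s≤s z≤n)) , (λ ()) , (λ ()) , (λ ())
... | no z≢0 | yes refl = Fin.zero , Fin.suc (Fin.suc Fin.zero) ,
      s≤s z≤n , s≤s (s≤s (s≤s z≤n)) , z≢0 , (λ ()) , (λ ())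
... | no z≢0 | no z≢1 = Fin.zero , Fin.suc Fin.zero , s≤s z≤n , s≤s (s≤s z≤n) , z≢0 , z≢1 , (λ ())

module _ (l d : ℕ) where

  Pt : Set
  Pt = V l d

  IL : Pt → Set
  IL = InL {l} {d}

  IL? : Decidable IL
  IL? x = toℕ x <? l

  Lset : Subset (l + d)
  Lset = tabulate (λ x → does (IL? x))

  L-block : IsBlock l d Lset
  L-block = inj₁ λ x → mk⇔ (to (does⇔ (IL? x)) ∘ to (∈-tabulate _))
                           (from (∈-tabulate _) ∘ from (does⇔ (IL? x)))

  LClosed : Subset (l + d) → Set
  LClosed S = ∀ x y → x ≢ y → x ∈ S → y ∈ S → IL x → IL y → ∀ z → IL z → z ∈ S

  subsystem⇒LClosed : ∀ S → IsSubsystem l d S → LClosed S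
  subsystem⇒LClosed S sub x y x≢y xS yS xL yL z zL =
    sub x y x≢y xS yS Lset L-block (from (∈-tabulate _) (from (does⇔ (IL? x)) xL))
      (from (∈-tabulate _) (from (does⇔ (IL? y)) yL)) (from (∈-tabulate _) (from (does⇔ (IL? z)) zL))

  -- The converse: the pair blocks {i, j} are automatically contained.
  LClosed⇒subsystem : ∀ S → LClosed S → IsSubsystem l d S
  LClosed⇒subsystem S closed x y x≢y xS yS B (inj₁ B≡L) xB yB {z} zB =
    closed x y x≢y xS yS (to (B≡L x) xB) (to (B≡L y) yB) z (to (B≡L z) zB)
  LClosed⇒subsystem S closed x y x≢y xS yS B (inj₂ (_ , _ , _ , _ , B≡ij)) xB yB {z} zB
    with pair-cover x≢y (to (B≡ij x) xB) (to (B≡ij y) yB) (to (B≡ij z) zB)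
  ... | inj₁ refl = xS
  ... | inj₂ refl = yS

  atMostOneL⇒subsystem : ∀ S → (∀ x y → x ∈ S → y ∈ S → IL x → IL y → x ≡ y) → IsSubsystem l d S
  atMostOneL⇒subsystem S one = LClosed⇒subsystem S λ x y x≢y xS yS xL yL _ _ →
    ⊥-elim (x≢y (one x y xS yS xL yL))

  singleton-subsystem : ∀ c → IsSubsystem l d ⁅ c ⁆
  singleton-subsystem c = atMostOneL⇒subsystem ⁅ c ⁆ λ x y xc yc _ _ →
    trans (x∈⁅y⁆⇒x≡y c xc) (sym (x∈⁅y⁆⇒x≡y c yc))

  preW-undefined : ∀ f {F x} → f x ≡ nothing → x ∈ preW l d f F
  preW-undefined f {F} e = from (∈-tabulate _) (cong (maybe (λ y → does (y ∈? F)) true) e)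

  preW-defined : ∀ f {F x y} → f x ≡ just y → x ∈ preW l d f F ⇔ y ∈ F
  preW-defined f {F} {y = y} e = mk⇔
    (λ m → to (does⇔ (y ∈? F)) (trans (sym (cong value e)) (to (∈-tabulate _) m)))
    (λ yF → from (∈-tabulate _) (trans (cong value e) (from (does⇔ (y ∈? F)) yF)))
    where
    value : Maybe Pt → Bool
    value = maybe (λ y → does (y ∈? F)) true

  MapsLIntoL InjectiveOnL OntoL : PFun l d → Set
  MapsLIntoL h = ∀ x → IL x → Σ Pt λ y → h x ≡ just y × IL y
  InjectiveOnL h = ∀ x y → IL x → IL y → h x ≡ h y → x ≡ y
  OntoL h = ∀ y → IL y → Σ Pt λ x → IL x × h x ≡ just y

  -- Counting: an injective map of L into L is onto L (transport to Fin l).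
  injective-on-L⇒onto-L : ∀ h → MapsLIntoL h → InjectiveOnL h → OntoL h
  injective-on-L⇒onto-L h maps inj y yL =
    fromL i , fromL-IL i , trans (image-eq i) (cong just image-i≡y)
    where
    fromL : Fin l → Pt
    fromL i = i ↑ˡ d
    fromL-IL : ∀ i → IL (fromL i)
    fromL-IL i = subst (_< l) (sym (toℕ-↑ˡ i d)) (toℕ<n i)
    fromL∘toL : ∀ x (xL : IL x) → fromL (fromℕ< xL) ≡ x
    fromL∘toL x xL = toℕ-injective (trans (toℕ-↑ˡ (fromℕ< xL) d) (toℕ-fromℕ< xL))
    image : Fin l → Pt
    image i = proj₁ (maps (fromL i) (fromL-IL i))
    image-eq : ∀ i → h (fromL i) ≡ just (image i)
    image-eq i = proj₁ (proj₂ (maps (fromL i) (fromL-IL i)))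
    image-IL : ∀ i → IL (image i)
    image-IL i = proj₂ (proj₂ (maps (fromL i) (fromL-IL i)))
    k : Fin l → Fin l
    k i = fromℕ< (image-IL i)
    fromL∘k : ∀ i → fromL (k i) ≡ image i
    fromL∘k i = fromL∘toL (image i) (image-IL i)
    k-injective : Injective _≡_ _≡_ k
    k-injective {i} {j} e = ↑ˡ-injective d i j (inj (fromL i) (fromL j) (fromL-IL i) (fromL-IL j)
      (trans (image-eq i) (trans (cong just same-image) (sym (image-eq j)))))
      where
      same-image : image i ≡ image j
      same-image = trans (sym (fromL∘k i)) (trans (cong fromL e) (fromL∘k j))
    i : Fin l
    i = proj₁ (injective⇒surjective k k-injective (fromℕ< yL))
    image-i≡y : image i ≡ y
    image-i≡y = trans (sym (fromL∘k i))
      (trans (cong fromL (proj₂ (injective⇒surjective k k-injective (fromℕ< yL)))) (fromL∘toL y yL))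

  permutesL : ∀ h → MapsLIntoL h → InjectiveOnL h → PermutesL l d h
  permutesL h maps inj = maps , inj , injective-on-L⇒onto-L h maps inj

  -- A map that is constant on L lies in W(l,d): its weak preimages contain
  -- either all of L or no point of L.
  constant-on-L⇒InW : ∀ h → (∀ x y → IL x → IL y → h x ≡ h y) → InW l d h
  constant-on-L⇒InW h const F _ = LClosed⇒subsystem _ λ x _ _ xS _ xL _ z zL →
    same-value (const z x zL xL) xS
    where
    same-value : ∀ {x z} → h z ≡ h x → x ∈ preW l d h F → z ∈ preW l d h F
    same-value {x} e xS with h x in hx
    ... | nothing = preW-undefined h e
    ... | just a = from (preW-defined h e) (to (preW-defined h hx) xS)

  -- A map sending L injectively into L lies in W(l,d): it pulls L-closed sets
  -- back to L-closed sets.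
  embeds-L⇒InW : ∀ h → MapsLIntoL h → InjectiveOnL h → InW l d h
  embeds-L⇒InW h maps inj F sub = LClosed⇒subsystem _ λ x y x≢y xS yS xL yL z zL →
    let (a , ha , aL) = maps x xL
        (b , hb , bL) = maps y yL
        (c , hc , cL) = maps z zL
        a≢b : a ≢ b
        a≢b a≡b = x≢y (inj x y xL yL (trans ha (trans (cong just a≡b) (sym hb))))
    in from (preW-defined h hc)
         (subsystem⇒LClosed F sub a b a≢b (to (preW-defined h ha) xS) (to (preW-defined h hb) yS) aL bL c cL)

  module _ {h : PFun l d} (hW : InW l d h) where

    spread : ∀ {F x y} → IsSubsystem l d F → x ≢ y → IL x → IL y →
      x ∈ preW l d h F → y ∈ preW l d h F → ∀ z → IL z → z ∈ preW l d h F
    spread {F} sub x≢y xL yL xS yS = subsystem⇒LClosed _ (hW F sub) _ _ x≢y xS yS xL yL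

    collapse : ∀ {c x y} → x ≢ y → IL x → IL y →
      x ∈ preW l d h ⁅ c ⁆ → y ∈ preW l d h ⁅ c ⁆ → ∀ z {a} → IL z → h z ≡ just a → a ≡ c
    collapse {c} x≢y xL yL xS yS z zL hz =
      x∈⁅y⁆⇒x≡y c (to (preW-defined h hz) (spread (singleton-subsystem c) x≢y xL yL xS yS z zL))

    module Rigidity (l≥3 : 3 ≤ l) {p q u v : Pt} (pL : IL p) (qL : IL q)
                    (hp : h p ≡ just u) (hq : h q ≡ just v) (u≢v : u ≢ v) where

      -- An undefined point z of L would lie with p in h^{-w}({u}), forcing v = u.
      defined-on-L : ∀ z → IL z → Σ Pt λ c → h z ≡ just c
      defined-on-L z zL with h z in hz
      ... | just c = c , refl
      ... | nothing = ⊥-elim (u≢v (sym (collapse z≢p zL pL (preW-undefined h hz)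
                                         (from (preW-defined h hp) (x∈⁅x⁆ u)) q qL hq)))
        where
        z≢p : z ≢ p
        z≢p refl with trans (sym hz) hp
        ... | ()

      -- Two distinct points of L with a common value c would force u = c = v.
      injective-on-L : InjectiveOnL h
      injective-on-L x y xL yL hx≡hy with x ≟ y
      ... | yes x≡y = x≡y
      ... | no x≢y = ⊥-elim (u≢v (trans (collapse′ p pL hp) (sym (collapse′ q qL hq))))
        where
        c = proj₁ (defined-on-L x xL)
        hx = proj₂ (defined-on-L x xL)
        collapse′ = collapse x≢y xL yL (from (preW-defined h hx) (x∈⁅x⁆ c))
                      (from (preW-defined h (trans (sym hx≡hy) hx)) (x∈⁅x⁆ c))

      -- A value c ∉ L at z: with w, r ∈ L further points, {c, c'} (c' = h w)
      -- is a subsystem whose weak preimage contains z and w, hence r, so h r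
      -- equals h z or h w, contradicting injectivity.
      maps-L-into-L : MapsLIntoL h
      maps-L-into-L z zL with defined-on-L z zL | two-more-in-L l≥3 z
      ... | c , hz | w , r , wL , rL , z≢w , z≢r , w≢r with IL? c
      ...   | yes cL = c , hz , cL
      ...   | no c∉L = ⊥-elim (r-collides (x∈p∪q⁻ ⁅ c ⁆ ⁅ c' ⁆ c''∈F))
        where
        c' = proj₁ (defined-on-L w wL)
        hw = proj₂ (defined-on-L w wL)
        c'' = proj₁ (defined-on-L r rL)
        hr = proj₂ (defined-on-L r rL)
        F = ⁅ c ⁆ ∪ ⁅ c' ⁆
        L-point-is-c' : ∀ x → x ∈ F → IL x → x ≡ c'
        L-point-is-c' x xF xL with x∈p∪q⁻ ⁅ c ⁆ ⁅ c' ⁆ xF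
        ... | inj₁ x∈c = ⊥-elim (c∉L (subst IL (x∈⁅y⁆⇒x≡y c x∈c) xL))
        ... | inj₂ x∈c' = x∈⁅y⁆⇒x≡y c' x∈c'
        F-subsystem : IsSubsystem l d F
        F-subsystem = atMostOneL⇒subsystem F λ x y xF yF xL yL →
          trans (L-point-is-c' x xF xL) (sym (L-point-is-c' y yF yL))
        c''∈F : c'' ∈ F
        c''∈F = to (preW-defined h hr) (spread F-subsystem z≢w zL wL
          (from (preW-defined h hz) (x∈p∪q⁺ (inj₁ (x∈⁅x⁆ c))))
          (from (preW-defined h hw) (x∈p∪q⁺ (inj₂ (x∈⁅x⁆ c')))) r rL)
        r-collides : c'' ∈ ⁅ c ⁆ ⊎ c'' ∈ ⁅ c' ⁆ → ⊥
        r-collides (inj₁ m) = z≢r (sym (injective-on-L r z rL zL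
          (trans hr (trans (cong just (x∈⁅y⁆⇒x≡y c m)) (sym hz)))))
        r-collides (inj₂ m) = w≢r (sym (injective-on-L r w rL wL
          (trans hr (trans (cong just (x∈⁅y⁆⇒x≡y c' m)) (sym hw)))))

  IsSection : PFun l d → PFun l d → Set
  IsSection f g = ∀ x y → f x ≡ just y → Σ Pt λ u → g y ≡ just u × f u ≡ just y

  regular⇔section : ∀ f → Regular l d f ⇔ Σ (PFun l d) λ g → InW l d g × IsSection f g
  regular⇔section f = mk⇔ (λ (g , gW , fgf) → g , gW , section g fgf)
                          (λ (g , gW , sec) → g , gW , fgf g sec)
    where
    section : ∀ g → (∀ x → compP l d f (compP l d g f) x ≡ f x) → IsSection f g
    section g fgf x y fx = returns-y (g y) (subst (λ m → ((m >>= g) >>= f) ≡ m) fx (fgf x))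
      where
      returns-y : ∀ m → (m >>= f) ≡ just y → Σ Pt λ u → m ≡ just u × f u ≡ just y
      returns-y (just u) fu = u , refl , fu
    fgf : ∀ g → IsSection f g → ∀ x → compP l d f (compP l d g f) x ≡ f x
    fgf g sec x with f x in fx
    ... | nothing = refl
    ... | just y = let (u , gy , fu) = sec x y fx in trans (cong (_>>= f) gy) fu

  LValued : Maybe Pt → Set
  LValued nothing = ⊥
  LValued (just a) = IL a

  LValued? : ∀ m → Dec (LValued m)
  LValued? nothing = no λ ()
  LValued? (just a) = IL? a

  TwoLValues : PFun l d → Set
  TwoLValues f = Σ Pt λ x → Σ Pt λ y → Σ Pt λ a → Σ Pt λ b →
    f x ≡ just a × f y ≡ just b × IL a × IL b × a ≢ b

  imageL-dichotomy : ∀ f → ImL≤1 l d f ⊎ TwoLValues f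
  imageL-dichotomy f = finite-dichotomy (λ x → finite-dichotomy (λ y → pair (f x) (f y)))
    where
    pair : ∀ m m' → (∀ a b → m ≡ just a → m' ≡ just b → IL a → IL b → a ≡ b)
                  ⊎ Σ Pt λ a → Σ Pt λ b → m ≡ just a × m' ≡ just b × IL a × IL b × a ≢ b
    pair nothing _ = inj₁ λ _ _ ()
    pair (just a) nothing = inj₁ λ _ _ _ ()
    pair (just a) (just b) with IL? a | IL? b | a ≟ b
    ... | no a∉L | _ | _ = inj₁ λ { _ _ refl refl aL _ → ⊥-elim (a∉L aL) }
    ... | _ | no b∉L | _ = inj₁ λ { _ _ refl refl _ bL → ⊥-elim (b∉L bL) }
    ... | _ | _ | yes a≡b = inj₁ λ { _ _ refl refl _ _ → a≡b }
    ... | yes aL | yes bL | no a≢b = inj₂ (a , b , refl , refl , aL , bL , a≢b)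

  -- (⇒) A section g takes the distinct values g a, g b on L; by rigidity they
  -- lie in L, so f takes distinct values on L and is rigid too.
  regular⇒cases : 3 ≤ l → ∀ f → InW l d f → Regular l d f → PermutesL l d f ⊎ ImL≤1 l d f
  regular⇒cases l≥3 f fW reg with imageL-dichotomy f | to (regular⇔section f) reg
  ... | inj₁ small | _ = inj₂ small
  ... | inj₂ (x , y , a , b , fx , fy , aL , bL , a≢b) | g , gW , sec
    with sec x a fx | sec y b fy
  ...   | u , ga , fu | v , gb , fv = inj₁ (permutesL f F.maps-L-into-L F.injective-on-L)
    where
    u≢v : u ≢ v
    u≢v u≡v = a≢b (just-injective (trans (sym fu) (trans (cong f u≡v) fv)))
    module G = Rigidity {h = g} gW l≥3 aL bL ga gb u≢v
    in-L : ∀ {c w} → IL c → g c ≡ just w → IL w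
    in-L {c} cL gc with G.maps-L-into-L c cL
    ... | _ , gc′ , wL = subst IL (just-injective (trans (sym gc′) gc)) wL
    module F = Rigidity {h = f} fW l≥3 (in-L aL ga) (in-L bL gb) fu fv a≢b

  _≟M_ : (m m' : Maybe Pt) → Dec (m ≡ m')
  _≟M_ = ≡-decMaybe _≟_

  glue : (Pt → Maybe Pt) → PFun l d → PFun l d
  glue onL f y with IL? y
  ... | yes _ = onL y
  ... | no _ = choose (λ x → f x ≟M just y)

  glue-on-L : ∀ onL f y → IL y → glue onL f y ≡ onL y
  glue-on-L onL f y yL with IL? y
  ... | yes _ = refl
  ... | no y∉L = ⊥-elim (y∉L yL)

  glue-section : ∀ onL f →
    (∀ x y → IL y → f x ≡ just y → Σ Pt λ u → onL y ≡ just u × f u ≡ just y) →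
    IsSection f (glue onL f)
  glue-section onL f onL-section x y fx with IL? y
  ... | yes yL = onL-section x y yL fx
  ... | no _ = let (u , gy) = choose-complete (λ x → f x ≟M just y) (x , fx)
               in u , gy , choose-sound (λ x → f x ≟M just y) gy

  -- (⇐), first case.  It suffices that every point of L is the image of a
  -- point of L: on L, g picks such a preimage, so g embeds L into L.
  onto-L⇒regular : ∀ f → OntoL f → Regular l d f
  onto-L⇒regular f f-onto =
    from (regular⇔section f) (g , embeds-L⇒InW g g-maps g-inj , glue-section inverse f inverse-section)
    where
    inverse : Pt → Maybe Pt
    inverse y = choose (λ x → IL? x ×-dec (f x ≟M just y))
    inverse-exists : ∀ y → IL y → Σ Pt λ u → inverse y ≡ just u × IL u × f u ≡ just y
    inverse-exists y yL =
      let (u , iy) = choose-complete (λ x → IL? x ×-dec (f x ≟M just y)) (f-onto y yL)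
      in u , iy , choose-sound (λ x → IL? x ×-dec (f x ≟M just y)) iy
    inverse-section : ∀ x y → IL y → f x ≡ just y → Σ Pt λ u → inverse y ≡ just u × f u ≡ just y
    inverse-section _ y yL _ = let (u , iy , _ , fu) = inverse-exists y yL in u , iy , fu
    g = glue inverse f
    g-maps : MapsLIntoL g
    g-maps y yL = let (u , iy , uL , _) = inverse-exists y yL in u , trans (glue-on-L inverse f y yL) iy , uL
    g-inj : InjectiveOnL g
    g-inj y y' yL y'L gy≡gy' =
      let (u , iy , _ , fu) = inverse-exists y yL
          (u' , iy' , _ , fu') = inverse-exists y' y'L
          u≡u' : u ≡ u'
          u≡u' = just-injective (trans (sym iy) (trans (sym (glue-on-L inverse f y yL))
                   (trans gy≡gy' (trans (glue-on-L inverse f y' y'L) iy'))))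
      in just-injective (trans (sym fu) (trans (cong f u≡u') fu'))

  -- (⇐), second case: g is constant on L, at a preimage of the unique point
  -- of Im f ∩ L (if any).
  smallImage⇒regular : ∀ f → ImL≤1 l d f → Regular l d f
  smallImage⇒regular f small = from (regular⇔section f)
    (g , constant-on-L⇒InW g g-const , glue-section (λ _ → c₀) f c₀-section)
    where
    c₀ : Maybe Pt
    c₀ = choose (λ x → LValued? (f x))
    c₀-section : ∀ x y → IL y → f x ≡ just y → Σ Pt λ u → c₀ ≡ just u × f u ≡ just y
    c₀-section x y yL fx with choose-complete (λ x → LValued? (f x)) (x , subst LValued (sym fx) yL)
    ... | u , c₀≡u with f u in fu | choose-sound (λ x → LValued? (f x)) c₀≡u
    ...   | just a | aL = u , c₀≡u , trans fu (cong just (small u x a y fu fx aL yL))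
    g = glue (λ _ → c₀) f
    g-const : ∀ x y → IL x → IL y → g x ≡ g y
    g-const x y xL yL = trans (glue-on-L _ f x xL) (sym (glue-on-L _ f y yL))

lemma9p10 : (l d : ℕ) → 3 ≤ l → 1 ≤ d → (f : PFun l d) → InW l d f →
    Regular l d f ⇔ (PermutesL l d f ⊎ ImL≤1 l d f)
lemma9p10 l d l≥3 _ f fW = mk⇔ (regular⇒cases l d l≥3 f fW) backward
  where
  backward : PermutesL l d f ⊎ ImL≤1 l d f → Regular l d f
  backward (inj₁ (_ , _ , onto)) = onto-L⇒regular l d f onto
  backward (inj₂ small) = smallImage⇒regular l d f small
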